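{- The series $\mathcal{V}_d(z,q)$ and $\mathcal{X}_d(z,q)$ belong to $\mathscr{T}_{z,q}^2$. In particular, for all integers $m,n\ge 0$: $V_d(m,n)>V_d(m+2,n)$ provided $V_d(m,n)\ne 0$, and $X_d(m,n)>X_d(m+2,n)$ provided $X_d(m,n)\ne0$.
   Context: $(a;q)_n=\prod_{0\le j<n}(1-aq^j)$ for $n\in\mathbb{N}_0\cup\{\infty\}$ and $(a,b;q)_n=(a;q)_n(b;q)_n$. Define $V_d(m,n),X_d(m,n)$ by $$\mathcal{V}_d(z,q)=\sum_{n\ge0}\sum_{m\in\mathbb{Z}}V_d(m,n)z^mq^n=\sum_{n\ge0}q^n(-zq^{n+1},-z^{ -1}q^{n+1};q)_\infty,\quad \mathcal{X}_d(z,q)=\sum_{n\ge0}\sum_{m\in\mathbb{Z}}X_d(m,n)z^mq^n=\sum_{n\ge0}q^{n+1}(-zq,-z^{ -1}q;q)_n$$ (these count strictly concave, resp. strictly convex, compositions of $n$ by rank $m$). For $\nu\in\{1,2\}$, $\mathscr{T}_z^\nu$ is the set of Laurent polynomials $\sum_ic_iz^i$ with real $c_i\ge0$, $c_{ -i}=c_i$, $c_{r+\ell\nu}\ge c_{r+(\ell+1)\nu}$ for all $0\le r<\nu$, $\ell\ge0$, and $c_{r+\ell\nu}>c_{r+(\ell+1)\nu}$ whenever $c_{r+\ell\nu}>0$. A series $\sum_nC_n(z)q^n$ with Laurent polynomial coefficients lies in $\mathscr{T}_{z,q}^\nu$ if every $C_n(z)\in\mathscr{T}_z^\nu$. -}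

module Defs where

open import Data.Nat using (ℕ; zero; suc)
import Data.Nat as ℕ
open import Data.Integer using (ℤ; +_; -_; _+_; _*_; _≤_; _<_)
import Data.Integer as ℤ
open import Data.List using (List; []; _∷_; _++_; map; concatMap; foldr)
open import Data.Product using (_×_; _,_)
open import Data.Bool using (Bool; true; false; _∧_; if_then_else_)
open import Relation.Nullary.Decidable using (⌊_⌋)
open import Relation.Binary.PropositionalEquality using (_≡_)

-- A finite bivariate polynomial, Laurent in z and ordinary in q, with
-- integer coefficients, represented as a list of monomials
-- (exponent of z , exponent of q , coefficient).
Poly : Set
Poly = List (ℤ × ℕ × ℤ)

one : Poly
one = (+ 0 , 0 , + 1) ∷ []

mono : ℤ → ℕ → ℤ → Poly
mono m n c = (m , n , c) ∷ []

_⊕_ : Poly → Poly → Poly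
p ⊕ r = p ++ r

_⊗_ : Poly → Poly → Poly
p ⊗ r = concatMap (λ { (a , b , c) → map (λ { (a' , b' , c') → (a + a' , b ℕ.+ b' , c * c') }) r }) p

neg : Poly → Poly
neg = map (λ { (a , b , c) → (a , b , - c) })

shiftq : ℕ → Poly → Poly
shiftq j = map (λ { (a , b , c) → (a , j ℕ.+ b , c) })

coeff : ℤ → ℕ → Poly → ℤ
coeff m n = foldr (λ { (a , b , c) acc → if ⌊ a ℤ.≟ m ⌋ ∧ ⌊ b ℕ.≟ n ⌋ then c + acc else acc }) (+ 0)

poch : Poly → ℕ → Poly
poch a zero    = one
poch a (suc k) = poch a k ⊗ (one ⊕ neg (shiftq k a))

sumTo : ℕ → (ℕ → Poly) → Poly
sumTo zero    f = f 0
sumTo (suc n) f = sumTo n f ⊕ f (suc n)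

mzq : ℕ → Poly
mzq s = mono (+ 1) s (- + 1)

mzinvq : ℕ → Poly
mzinvq s = mono (- + 1) s (- + 1)

-- V_d(m,n): coefficient of z^m q^n in  Σ_{k≥0} q^k (-z q^{k+1}, -z^{-1} q^{k+1}; q)_∞.
-- Formal power series in q: the coefficient of q^n of an infinite product
-- (a;q)_∞ (a with nonnegative q-exponents) is that of the partial product
-- (a;q)_{n+1}; the summands with k > n contribute only to q^{>n}.
V : ℤ → ℕ → ℤ
V m n = coeff m n (sumTo n (λ k →
          shiftq k (poch (mzq (suc k)) (suc n) ⊗ poch (mzinvq (suc k)) (suc n))))

-- X_d(m,n): coefficient of z^m q^n in  Σ_{k≥0} q^{k+1} (-z q, -z^{-1} q; q)_k.
-- Summands with k ≥ n contribute only to q^{>n}.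
X : ℤ → ℕ → ℤ
X m n = coeff m n (sumTo n (λ k →
          shiftq (suc k) (poch (mzq 1) k ⊗ poch (mzinvq 1) k)))

-- The Laurent polynomial Σ_i c_i z^i (given by its coefficient function c)
-- lies in 𝒯_z^2 : c_i ≥ 0, c_{-i} = c_i, and for all r ∈ {0,1}, ℓ ≥ 0
-- (i.e. for all i = r + 2ℓ ≥ 0): c_i ≥ c_{i+2}, strictly whenever c_i > 0.
InT2 : (ℤ → ℤ) → Set
InT2 c =
  ((i : ℤ) → + 0 ≤ c i) ×
  ((i : ℤ) → c (- i) ≡ c i) ×
  ((r ℓ : ℕ) → r ℕ.< 2 →
     (c (+ (r ℕ.+ ℓ ℕ.* 2)) ≥' c (+ (r ℕ.+ (suc ℓ) ℕ.* 2))) ×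
     (+ 0 < c (+ (r ℕ.+ ℓ ℕ.* 2)) → c (+ (r ℕ.+ (suc ℓ) ℕ.* 2)) < c (+ (r ℕ.+ ℓ ℕ.* 2))))
  where
  _≥'_ : ℤ → ℤ → Set
  x ≥' y = y ≤ x

InT2zq : (ℤ → ℕ → ℤ) → Set
InT2zq c = (n : ℕ) → InT2 (λ m → c m n)

{-# OPTIONS --safe #-}
-- Each summand of 𝒱_d and 𝒳_d is a q-shift of (-zq^s, -z⁻¹q^s; q)_k, a product of factors
-- (1 + zq^t)(1 + z⁻¹q^t) = 1 + (z + z⁻¹)q^t + q^{2t}.  Coefficientwise in q, the class 𝒯²
-- contains 1 and is closed under sums, under multiplication by q^t, and under multiplication
-- by z + z⁻¹: the sequence d(i-1) + d(i+1) inherits symmetry and monotonicity in steps of 2,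
-- and a plateau of it is a plateau of d at i+1, where d must then vanish.
-- Products are handled through the action of a polynomial on coefficient arrays: the
-- coefficients of P ⊗ Q arise by letting either factor act on the other, and actions commute.
module Submission where

open import Defs
open import Data.Bool using (true; false; _∧_; if_then_else_)
open import Data.Bool.Properties using (∧-zeroʳ)
open import Data.Integer using (ℤ; +_; -[1+_]; -_; _+_; _-_; _*_; _≤_; _<_; +≤+)
import Data.Integer as ℤ
import Data.Integer.Properties as ℤP
open import Data.Integer.Tactic.RingSolver using (solve-∀)
open import Data.List using ([]; _∷_; _++_; map)
open import Data.Nat using (ℕ; zero; suc; z≤n)
import Data.Nat as ℕ
import Data.Nat.Properties as ℕP
open import Data.Product using (_×_; _,_)
open import Function.Bundles using (_⇔_; mk⇔)
open import Relation.Nullary.Decidable using (Dec; ⌊_⌋; isYes≗does; does-⇔)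
open import Relation.Binary.PropositionalEquality
open import Algebra.Properties.CommutativeSemigroup ℤP.+-commutativeSemigroup using (interchange)
open import Algebra.Properties.CommutativeSemigroup ℤP.*-commutativeSemigroup using (x∙yz≈y∙xz)

open ≡-Reasoning

Monomial : Set
Monomial = ℤ × ℕ × ℤ

Series : Set
Series = ℤ → ℕ → ℤ

infix  4 _≐_
infixl 6 _⊞_
infixr 7 _⋆_ _·_

_≐_ : Series → Series → Set
D ≐ E = ∀ m → D m ≗ E m

⟦_⟧ : Poly → Series
⟦ P ⟧ m n = coeff m n P

0ˢ : Series
0ˢ _ _ = + 0

_⊞_ : Series → Series → Series
(D ⊞ E) m n = D m n + E m n

_⋆_ : ℤ → Series → Series
(c ⋆ D) m n = c * D m n

qShift : ℕ → (ℕ → ℤ) → ℕ → ℤ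
qShift zero    f n       = f n
qShift (suc s) f zero    = + 0
qShift (suc s) f (suc n) = qShift s f n

qShiftˢ : ℕ → Series → Series
qShiftˢ s D m = qShift s (D m)

shift : ℤ → ℕ → Series → Series
shift e s D m = qShift s (D (m - e))

z+z⁻¹ : Series → Series
z+z⁻¹ D m n = D (m - + 1) n + D (m + + 1) n

monomial : Monomial → Series
monomial (a , b , c) m n = if ⌊ a ℤ.≟ m ⌋ ∧ ⌊ b ℕ.≟ n ⌋ then c else + 0

_⊙_ : Monomial → Monomial → Monomial
(a , b , c) ⊙ (a′ , b′ , c′) = (a + a′ , b ℕ.+ b′ , c * c′)

_·_ : Poly → Series → Series
[]                · D = 0ˢ
((a , b , c) ∷ P) · D = c ⋆ shift a b D ⊞ P · D

qShift-cong : ∀ s {f g : ℕ → ℤ} → f ≗ g → qShift s f ≗ qShift s g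
qShift-cong zero    f≗g n       = f≗g n
qShift-cong (suc s) f≗g zero    = refl
qShift-cong (suc s) f≗g (suc n) = qShift-cong s f≗g n

qShift-0 : ∀ s → qShift s (λ _ → + 0) ≗ λ _ → + 0
qShift-0 zero    n       = refl
qShift-0 (suc s) zero    = refl
qShift-0 (suc s) (suc n) = qShift-0 s n

qShift-+ : ∀ s (f g : ℕ → ℤ) → qShift s (λ n → f n + g n) ≗ λ n → qShift s f n + qShift s g n
qShift-+ zero    f g n       = refl
qShift-+ (suc s) f g zero    = refl
qShift-+ (suc s) f g (suc n) = qShift-+ s f g n

qShift-* : ∀ s c (f : ℕ → ℤ) → qShift s (λ n → c * f n) ≗ λ n → c * qShift s f n
qShift-* zero    c f n       = refl
qShift-* (suc s) c f zero    = sym (ℤP.*-zeroʳ c)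
qShift-* (suc s) c f (suc n) = qShift-* s c f n

qShift-qShift : ∀ s t (f : ℕ → ℤ) → qShift s (qShift t f) ≗ qShift (s ℕ.+ t) f
qShift-qShift zero    t f n       = refl
qShift-qShift (suc s) t f zero    = refl
qShift-qShift (suc s) t f (suc n) = qShift-qShift s t f n

qShift-comm : ∀ s t (f : ℕ → ℤ) → qShift s (qShift t f) ≗ qShift t (qShift s f)
qShift-comm s t f n = begin
  qShift s (qShift t f) n ≡⟨ qShift-qShift s t f n ⟩
  qShift (s ℕ.+ t) f n    ≡⟨ cong (λ u → qShift u f n) (ℕP.+-comm s t) ⟩
  qShift (t ℕ.+ s) f n    ≡⟨ qShift-qShift t s f n ⟨
  qShift t (qShift s f) n ∎

shift-cong : ∀ e s {D E} → D ≐ E → shift e s D ≐ shift e s E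
shift-cong e s D≐E m = qShift-cong s (D≐E (m - e))

shift-⊞ : ∀ e s D E → shift e s (D ⊞ E) ≐ shift e s D ⊞ shift e s E
shift-⊞ e s D E m = qShift-+ s (D (m - e)) (E (m - e))

shift-⋆ : ∀ e s c D → shift e s (c ⋆ D) ≐ c ⋆ shift e s D
shift-⋆ e s c D m = qShift-* s c (D (m - e))

shift-comm : ∀ e s e′ s′ D → shift e s (shift e′ s′ D) ≐ shift e′ s′ (shift e s D)
shift-comm e s e′ s′ D m n = begin
  qShift s (qShift s′ (D (m - e - e′))) n ≡⟨ qShift-comm s s′ _ n ⟩
  qShift s′ (qShift s (D (m - e - e′))) n ≡⟨ cong (λ k → qShift s′ (qShift s (D k)) n) (sub-comm m e e′) ⟩
  qShift s′ (qShift s (D (m - e′ - e))) n ∎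
  where
  sub-comm : ∀ (m e e′ : ℤ) → m - e - e′ ≡ m - e′ - e
  sub-comm = solve-∀

·-cong : ∀ P {D E} → D ≐ E → P · D ≐ P · E
·-cong []                D≐E m n = refl
·-cong ((a , b , c) ∷ P) D≐E m n =
  cong₂ _+_ (cong (c *_) (shift-cong a b D≐E m n)) (·-cong P D≐E m n)

·-0 : ∀ P → P · 0ˢ ≐ 0ˢ
·-0 []                m n = refl
·-0 ((a , b , c) ∷ P) m n =
  cong₂ _+_ (trans (cong (c *_) (qShift-0 b n)) (ℤP.*-zeroʳ c)) (·-0 P m n)

·-⊞ : ∀ P D E → P · (D ⊞ E) ≐ P · D ⊞ P · E
·-⊞ []                D E m n = refl
·-⊞ ((a , b , c) ∷ P) D E m n = begin
  c * shift a b (D ⊞ E) m n + (P · (D ⊞ E)) m n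
    ≡⟨ cong₂ _+_ (trans (cong (c *_) (shift-⊞ a b D E m n)) (ℤP.*-distribˡ-+ c _ _))
                 (·-⊞ P D E m n) ⟩
  (c * shift a b D m n + c * shift a b E m n) + ((P · D) m n + (P · E) m n)
    ≡⟨ interchange (c * shift a b D m n) _ _ _ ⟩
  (c * shift a b D m n + (P · D) m n) + (c * shift a b E m n + (P · E) m n) ∎

·-⋆ : ∀ P c D → P · (c ⋆ D) ≐ c ⋆ P · D
·-⋆ []                 c D m n = sym (ℤP.*-zeroʳ c)
·-⋆ ((a , b , c′) ∷ P) c D m n = begin
  c′ * shift a b (c ⋆ D) m n + (P · (c ⋆ D)) m n
    ≡⟨ cong₂ _+_ (cong (c′ *_) (shift-⋆ a b c D m n)) (·-⋆ P c D m n) ⟩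
  c′ * (c * shift a b D m n) + c * (P · D) m n
    ≡⟨ cong (_+ c * (P · D) m n) (x∙yz≈y∙xz c′ c _) ⟩
  c * (c′ * shift a b D m n) + c * (P · D) m n
    ≡⟨ ℤP.*-distribˡ-+ c _ _ ⟨
  c * (c′ * shift a b D m n + (P · D) m n) ∎

·-shift : ∀ P e s D → P · shift e s D ≐ shift e s (P · D)
·-shift []                e s D m n = sym (qShift-0 s n)
·-shift ((a , b , c) ∷ P) e s D m n = begin
  c * shift a b (shift e s D) m n + (P · shift e s D) m n
    ≡⟨ cong₂ _+_ (cong (c *_) (shift-comm a b e s D m n)) (·-shift P e s D m n) ⟩
  c * shift e s (shift a b D) m n + shift e s (P · D) m n
    ≡⟨ cong (_+ shift e s (P · D) m n) (shift-⋆ e s c (shift a b D) m n) ⟨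
  shift e s (c ⋆ shift a b D) m n + shift e s (P · D) m n
    ≡⟨ shift-⊞ e s (c ⋆ shift a b D) (P · D) m n ⟨
  shift e s (c ⋆ shift a b D ⊞ P · D) m n ∎

·-comm : ∀ P R D → P · R · D ≐ R · P · D
·-comm []                R D m n = sym (·-0 R m n)
·-comm ((a , b , c) ∷ P) R D m n = begin
  c * shift a b (R · D) m n + (P · R · D) m n
    ≡⟨ cong₂ _+_ (cong (c *_) (sym (·-shift R a b D m n))) (·-comm P R D m n) ⟩
  c * (R · shift a b D) m n + (R · P · D) m n
    ≡⟨ cong (_+ (R · P · D) m n) (·-⋆ R c (shift a b D) m n) ⟨
  (R · c ⋆ shift a b D) m n + (R · P · D) m n
    ≡⟨ ·-⊞ R (c ⋆ shift a b D) (P · D) m n ⟨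
  (R · (c ⋆ shift a b D ⊞ P · D)) m n ∎

⟦⟧-∷ : ∀ x P → ⟦ x ∷ P ⟧ ≐ monomial x ⊞ ⟦ P ⟧
⟦⟧-∷ (a , b , c) P m n with ⌊ a ℤ.≟ m ⌋ ∧ ⌊ b ℕ.≟ n ⌋
... | true  = refl
... | false = sym (ℤP.+-identityˡ _)

⟦⟧-++ : ∀ P Q → ⟦ P ++ Q ⟧ ≐ ⟦ P ⟧ ⊞ ⟦ Q ⟧
⟦⟧-++ []      Q m n = sym (ℤP.+-identityˡ _)
⟦⟧-++ (x ∷ P) Q m n = begin
  ⟦ x ∷ P ++ Q ⟧ m n                         ≡⟨ ⟦⟧-∷ x (P ++ Q) m n ⟩
  monomial x m n + ⟦ P ++ Q ⟧ m n            ≡⟨ cong (λ t → monomial x m n + t) (⟦⟧-++ P Q m n) ⟩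
  monomial x m n + (⟦ P ⟧ m n + ⟦ Q ⟧ m n)   ≡⟨ ℤP.+-assoc (monomial x m n) _ _ ⟨
  (monomial x m n + ⟦ P ⟧ m n) + ⟦ Q ⟧ m n   ≡⟨ cong (_+ ⟦ Q ⟧ m n) (⟦⟧-∷ x P m n) ⟨
  ⟦ x ∷ P ⟧ m n + ⟦ Q ⟧ m n                  ∎

-- does-⇔ for ⌊_⌋ (= isYes), which does not reduce to does when the decision is stuck.
⌊⌋-⇔ : ∀ {A B : Set} → A ⇔ B → (a? : Dec A) (b? : Dec B) → ⌊ a? ⌋ ≡ ⌊ b? ⌋
⌊⌋-⇔ A⇔B a? b? = trans (isYes≗does a?) (trans (does-⇔ A⇔B a? b?) (sym (isYes≗does b?)))

monomial-qShift : ∀ a b c s m → monomial (a , s ℕ.+ b , c) m ≗ qShift s (monomial (a , b , c) m)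
monomial-qShift a b c zero    m n       = refl
monomial-qShift a b c (suc s) m zero    = cong (if_then c else + 0) (∧-zeroʳ ⌊ a ℤ.≟ m ⌋)
monomial-qShift a b c (suc s) m (suc n) =
  trans (cong (λ t → if ⌊ a ℤ.≟ m ⌋ ∧ t then c else + 0)
              (⌊⌋-⇔ (mk⇔ ℕP.suc-injective (cong suc)) (suc (s ℕ.+ b) ℕ.≟ suc n) (s ℕ.+ b ℕ.≟ n)))
        (monomial-qShift a b c s m n)

monomial-zShift : ∀ a a′ b c m → monomial (a + a′ , b , c) m ≗ monomial (a′ , b , c) (m - a)
monomial-zShift a a′ b c m n =
  cong (λ t → if t ∧ ⌊ b ℕ.≟ n ⌋ then c else + 0)
       (⌊⌋-⇔ (mk⇔ (λ eq → trans (cancelˡ a a′) (cong (_- a) eq))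
                    (λ eq → trans (cong (_+_ a) eq) (sym (cancelʳ a m))))
               (a + a′ ℤ.≟ m) (a′ ℤ.≟ m - a))
  where
  cancelˡ : ∀ a a′ → a′ ≡ a + a′ - a
  cancelˡ = solve-∀
  cancelʳ : ∀ a m → m ≡ a + (m - a)
  cancelʳ = solve-∀

monomial-⋆ : ∀ a b c c′ → monomial (a , b , c * c′) ≐ c ⋆ monomial (a , b , c′)
monomial-⋆ a b c c′ m n with ⌊ a ℤ.≟ m ⌋ ∧ ⌊ b ℕ.≟ n ⌋
... | true  = refl
... | false = sym (ℤP.*-zeroʳ c)

monomial-⊙ : ∀ a b c y → monomial ((a , b , c) ⊙ y) ≐ c ⋆ shift a b (monomial y)
monomial-⊙ a b c (a′ , b′ , c′) m n = begin
  monomial (a + a′ , b ℕ.+ b′ , c * c′) m n     ≡⟨ monomial-zShift a a′ _ _ m n ⟩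
  monomial (a′ , b ℕ.+ b′ , c * c′) (m - a) n   ≡⟨ monomial-⋆ a′ _ c c′ (m - a) n ⟩
  c * monomial (a′ , b ℕ.+ b′ , c′) (m - a) n   ≡⟨ cong (c *_) (monomial-qShift a′ b′ c′ b (m - a) n) ⟩
  c * shift a b (monomial (a′ , b′ , c′)) m n   ∎

⊙-comm : ∀ x y → x ⊙ y ≡ y ⊙ x
⊙-comm (a , b , c) (a′ , b′ , c′) =
  cong₂ _,_ (ℤP.+-comm a a′) (cong₂ _,_ (ℕP.+-comm b b′) (ℤP.*-comm c c′))

⟦map⊙⟧ˡ : ∀ a b c Q → ⟦ map ((a , b , c) ⊙_) Q ⟧ ≐ c ⋆ shift a b ⟦ Q ⟧
⟦map⊙⟧ˡ a b c []      m n = sym (trans (cong (c *_) (qShift-0 b n)) (ℤP.*-zeroʳ c))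
⟦map⊙⟧ˡ a b c (y ∷ Q) m n = begin
  ⟦ x ⊙ y ∷ map (x ⊙_) Q ⟧ m n
    ≡⟨ ⟦⟧-∷ (x ⊙ y) (map (x ⊙_) Q) m n ⟩
  monomial (x ⊙ y) m n + ⟦ map (x ⊙_) Q ⟧ m n
    ≡⟨ cong₂ _+_ (monomial-⊙ a b c y m n) (⟦map⊙⟧ˡ a b c Q m n) ⟩
  c * shift a b (monomial y) m n + c * shift a b ⟦ Q ⟧ m n
    ≡⟨ ℤP.*-distribˡ-+ c _ _ ⟨
  c * (shift a b (monomial y) m n + shift a b ⟦ Q ⟧ m n)
    ≡⟨ cong (c *_) (shift-⊞ a b (monomial y) ⟦ Q ⟧ m n) ⟨
  c * shift a b (monomial y ⊞ ⟦ Q ⟧) m n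
    ≡⟨ cong (c *_) (shift-cong a b (⟦⟧-∷ y Q) m n) ⟨
  c * shift a b ⟦ y ∷ Q ⟧ m n ∎
  where
  x : Monomial
  x = (a , b , c)

⟦map⊙⟧ʳ : ∀ x Q → ⟦ map (x ⊙_) Q ⟧ ≐ Q · monomial x
⟦map⊙⟧ʳ x []                m n = refl
⟦map⊙⟧ʳ x ((a , b , c) ∷ Q) m n = begin
  ⟦ x ⊙ y ∷ map (x ⊙_) Q ⟧ m n                ≡⟨ ⟦⟧-∷ (x ⊙ y) (map (x ⊙_) Q) m n ⟩
  monomial (x ⊙ y) m n + ⟦ map (x ⊙_) Q ⟧ m n  ≡⟨ cong₂ _+_ (cong (λ z → monomial z m n) (⊙-comm x y))
                                                           (⟦map⊙⟧ʳ x Q m n) ⟩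
  monomial (y ⊙ x) m n + (Q · monomial x) m n  ≡⟨ cong (_+ (Q · monomial x) m n) (monomial-⊙ a b c x m n) ⟩
  ((y ∷ Q) · monomial x) m n                   ∎
  where
  y : Monomial
  y = (a , b , c)

⟦⊗⟧ˡ : ∀ P Q → ⟦ P ⊗ Q ⟧ ≐ P · ⟦ Q ⟧
⟦⊗⟧ˡ []                Q m n = refl
⟦⊗⟧ˡ ((a , b , c) ∷ P) Q m n =
  trans (⟦⟧-++ (map ((a , b , c) ⊙_) Q) (P ⊗ Q) m n)
        (cong₂ _+_ (⟦map⊙⟧ˡ a b c Q m n) (⟦⊗⟧ˡ P Q m n))

⟦⊗⟧ʳ : ∀ P Q → ⟦ P ⊗ Q ⟧ ≐ Q · ⟦ P ⟧
⟦⊗⟧ʳ []      Q m n = sym (·-0 Q m n)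
⟦⊗⟧ʳ (x ∷ P) Q m n = begin
  ⟦ map (x ⊙_) Q ++ P ⊗ Q ⟧ m n              ≡⟨ ⟦⟧-++ (map (x ⊙_) Q) (P ⊗ Q) m n ⟩
  ⟦ map (x ⊙_) Q ⟧ m n + ⟦ P ⊗ Q ⟧ m n       ≡⟨ cong₂ _+_ (⟦map⊙⟧ʳ x Q m n) (⟦⊗⟧ʳ P Q m n) ⟩
  (Q · monomial x) m n + (Q · ⟦ P ⟧) m n     ≡⟨ ·-⊞ Q (monomial x) ⟦ P ⟧ m n ⟨
  (Q · (monomial x ⊞ ⟦ P ⟧)) m n             ≡⟨ ·-cong Q (⟦⟧-∷ x P) m n ⟨
  (Q · ⟦ x ∷ P ⟧) m n                        ∎

⟦⊗⟧-factorʳ : ∀ P Q R → ⟦ P ⊗ (Q ⊗ R) ⟧ ≐ R · ⟦ P ⊗ Q ⟧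
⟦⊗⟧-factorʳ P Q R m n = begin
  ⟦ P ⊗ (Q ⊗ R) ⟧ m n   ≡⟨ ⟦⊗⟧ˡ P (Q ⊗ R) m n ⟩
  (P · ⟦ Q ⊗ R ⟧) m n   ≡⟨ ·-cong P (⟦⊗⟧ʳ Q R) m n ⟩
  (P · R · ⟦ Q ⟧) m n   ≡⟨ ·-comm P R ⟦ Q ⟧ m n ⟩
  (R · P · ⟦ Q ⟧) m n   ≡⟨ ·-cong R (⟦⊗⟧ˡ P Q) m n ⟨
  (R · ⟦ P ⊗ Q ⟧) m n   ∎

⟦⊗⟧-factorˡ : ∀ P Q R → ⟦ (P ⊗ R) ⊗ Q ⟧ ≐ R · ⟦ P ⊗ Q ⟧
⟦⊗⟧-factorˡ P Q R m n = begin
  ⟦ (P ⊗ R) ⊗ Q ⟧ m n   ≡⟨ ⟦⊗⟧ʳ (P ⊗ R) Q m n ⟩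
  (Q · ⟦ P ⊗ R ⟧) m n   ≡⟨ ·-cong Q (⟦⊗⟧ʳ P R) m n ⟩
  (Q · R · ⟦ P ⟧) m n   ≡⟨ ·-comm Q R ⟦ P ⟧ m n ⟩
  (R · Q · ⟦ P ⟧) m n   ≡⟨ ·-cong R (⟦⊗⟧ʳ P Q) m n ⟨
  (R · ⟦ P ⊗ Q ⟧) m n   ∎

⟦shiftq⟧ : ∀ j P → ⟦ shiftq j P ⟧ ≐ qShiftˢ j ⟦ P ⟧
⟦shiftq⟧ j []                m n = sym (qShift-0 j n)
⟦shiftq⟧ j ((a , b , c) ∷ P) m n = begin
  ⟦ (a , j ℕ.+ b , c) ∷ shiftq j P ⟧ m n
    ≡⟨ ⟦⟧-∷ (a , j ℕ.+ b , c) (shiftq j P) m n ⟩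
  monomial (a , j ℕ.+ b , c) m n + ⟦ shiftq j P ⟧ m n
    ≡⟨ cong₂ _+_ (monomial-qShift a b c j m n) (⟦shiftq⟧ j P m n) ⟩
  qShift j (monomial (a , b , c) m) n + qShift j (⟦ P ⟧ m) n
    ≡⟨ qShift-+ j (monomial (a , b , c) m) (⟦ P ⟧ m) n ⟨
  qShift j (λ k → monomial (a , b , c) m k + ⟦ P ⟧ m k) n
    ≡⟨ qShift-cong j (⟦⟧-∷ (a , b , c) P m) n ⟨
  qShift j (⟦ (a , b , c) ∷ P ⟧ m) n ∎

binomial : ℤ → ℕ → Poly
binomial e s = one ⊕ mono e s (+ 1)

binomial-· : ∀ e s D → binomial e s · D ≐ D ⊞ shift e s D
binomial-· e s D m n =
  cong₂ _+_ (trans (ℤP.*-identityˡ _) (cong (λ k → D k n) (ℤP.+-identityʳ m)))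
            (trans (ℤP.+-identityʳ _) (ℤP.*-identityˡ _))

binomialPair-· : ∀ s D → binomial (- + 1) s · binomial (+ 1) s · D
                          ≐ D ⊞ qShiftˢ s (z+z⁻¹ D) ⊞ qShiftˢ s (qShiftˢ s D)
binomialPair-· s D m n = begin
  (binomial (- + 1) s · G) m n
    ≡⟨ binomial-· (- + 1) s G m n ⟩
  G m n + shift (- + 1) s G m n
    ≡⟨ cong₂ _+_ (binomial-· (+ 1) s D m n) (shift-cong (- + 1) s (binomial-· (+ 1) s D) m n) ⟩
  (D m n + x) + qShift s (λ k → D (m + + 1) k + qShift s (D (m + + 1 - + 1)) k) n
    ≡⟨ cong (λ t → D m n + x + t) (qShift-+ s (D (m + + 1)) _ n) ⟩
  (D m n + x) + (y + qShift s (qShift s (D (m + + 1 - + 1))) n)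
    ≡⟨ ℤP.+-assoc (D m n + x) y _ ⟨
  ((D m n + x) + y) + qShift s (qShift s (D (m + + 1 - + 1))) n
    ≡⟨ cong₂ _+_ (trans (ℤP.+-assoc (D m n) x y) (cong (λ t → D m n + t) (sym (qShift-+ s _ _ n))))
                 (cong (λ k → qShift s (qShift s (D k)) n) (m+1-1≡m m)) ⟩
  (D ⊞ qShiftˢ s (z+z⁻¹ D) ⊞ qShiftˢ s (qShiftˢ s D)) m n ∎
  where
  G : Series
  G = binomial (+ 1) s · D
  x y : ℤ
  x = qShift s (D (m - + 1)) n
  y = qShift s (D (m + + 1)) n
  m+1-1≡m : ∀ m → m + + 1 - + 1 ≡ m
  m+1-1≡m m = trans (ℤP.+-assoc m (+ 1) (- + 1)) (ℤP.+-identityʳ m)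

-- The paper's 𝒯_z^2, with strictness in the equivalent form: a two-step plateau is at 0.
record 𝒯² (d : ℤ → ℤ) : Set where
  field
    nonneg    : ∀ i → + 0 ≤ d i
    symmetric : ∀ i → d (- i) ≡ d i
    antitone  : ∀ i → d (+ suc (suc i)) ≤ d (+ i)
    strict    : ∀ i → d (+ i) ≡ d (+ suc (suc i)) → d (+ i) ≡ + 0
open 𝒯²

+-tight : ∀ {a a′ b b′ : ℤ} → a′ ≤ a → b′ ≤ b → a + b ≡ a′ + b′ → a ≡ a′ × b ≡ b′
+-tight a′≤a b′≤b eq =
  ℤP.≤-antisym (ℤP.≮⇒≥ (λ a′<a → ℤP.<-irrefl (sym eq) (ℤP.+-mono-<-≤ a′<a b′≤b))) a′≤a ,
  ℤP.≤-antisym (ℤP.≮⇒≥ (λ b′<b → ℤP.<-irrefl (sym eq) (ℤP.+-mono-≤-< a′≤a b′<b))) b′≤b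

𝒯²-cong : ∀ {d d′} → (∀ i → d i ≡ d′ i) → 𝒯² d → 𝒯² d′
𝒯²-cong d≗d′ t = record
  { nonneg    = λ i → subst (+ 0 ≤_) (d≗d′ i) (nonneg t i)
  ; symmetric = λ i → trans (sym (d≗d′ (- i))) (trans (symmetric t i) (d≗d′ i))
  ; antitone  = λ i → subst₂ _≤_ (d≗d′ _) (d≗d′ _) (antitone t i)
  ; strict    = λ i eq → trans (sym (d≗d′ _)) (strict t i (trans (d≗d′ _) (trans eq (sym (d≗d′ _)))))
  }

𝒯²-0 : 𝒯² (λ _ → + 0)
𝒯²-0 = record
  { nonneg = λ _ → ℤP.≤-refl ; symmetric = λ _ → refl ; antitone = λ _ → ℤP.≤-refl ; strict = λ _ _ → refl }

δ₀ : ℤ → ℤ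
δ₀ (+ zero) = + 1
δ₀ _        = + 0

𝒯²-δ₀ : 𝒯² δ₀
𝒯²-δ₀ = record { nonneg = nonneg-δ₀ ; symmetric = symmetric-δ₀ ; antitone = λ i → nonneg-δ₀ (+ i) ; strict = strict-δ₀ }
  where
  nonneg-δ₀ : ∀ i → + 0 ≤ δ₀ i
  nonneg-δ₀ (+ zero)  = +≤+ z≤n
  nonneg-δ₀ (+ suc _) = +≤+ z≤n
  nonneg-δ₀ -[1+ _ ]  = +≤+ z≤n
  symmetric-δ₀ : ∀ i → δ₀ (- i) ≡ δ₀ i
  symmetric-δ₀ (+ zero)  = refl
  symmetric-δ₀ (+ suc _) = refl
  symmetric-δ₀ -[1+ _ ]  = refl
  strict-δ₀ : ∀ i → δ₀ (+ i) ≡ δ₀ (+ suc (suc i)) → δ₀ (+ i) ≡ + 0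
  strict-δ₀ zero    ()
  strict-δ₀ (suc i) _ = refl

𝒯²-+ : ∀ {d e} → 𝒯² d → 𝒯² e → 𝒯² (λ i → d i + e i)
𝒯²-+ td te = record
  { nonneg    = λ i → ℤP.+-mono-≤ (nonneg td i) (nonneg te i)
  ; symmetric = λ i → cong₂ _+_ (symmetric td i) (symmetric te i)
  ; antitone  = λ i → ℤP.+-mono-≤ (antitone td i) (antitone te i)
  ; strict    = λ i eq → let (d-eq , e-eq) = +-tight (antitone td i) (antitone te i) eq
                         in cong₂ _+_ (strict td i d-eq) (strict te i e-eq)
  }

𝒯²-z+z⁻¹ : ∀ {d} → 𝒯² d → 𝒯² (λ i → d (i - + 1) + d (i + + 1))
𝒯²-z+z⁻¹ {d} t = record
  { nonneg    = λ i → ℤP.+-mono-≤ (nonneg t _) (nonneg t _)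
  ; symmetric = symmetric′
  ; antitone  = λ i → ℤP.+-mono-≤ (below i) (above i)
  ; strict    = strict′
  }
  where
  up : ∀ i → d (+ i + + 1) ≡ d (+ suc i)
  up i = cong (λ k → d (+ k)) (ℕP.+-comm i 1)
  below : ∀ i → d (+ suc i) ≤ d (+ i - + 1)
  below zero    = ℤP.≤-reflexive (sym (symmetric t (+ 1)))
  below (suc i) = antitone t i
  above : ∀ i → d (+ suc (suc i) + + 1) ≤ d (+ i + + 1)
  above i = subst₂ _≤_ (sym (up (suc (suc i)))) (sym (up i)) (antitone t (suc i))
  symmetric′ : ∀ i → d (- i - + 1) + d (- i + + 1) ≡ d (i - + 1) + d (i + + 1)
  symmetric′ i = begin
    d (- i - + 1) + d (- i + + 1)       ≡⟨ cong₂ (λ j k → d j + d k) (ℤP.neg-distrib-+ i (+ 1))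
                                                                   (ℤP.neg-distrib-+ i (- + 1)) ⟨
    d (- (i + + 1)) + d (- (i - + 1))   ≡⟨ cong₂ _+_ (symmetric t _) (symmetric t _) ⟩
    d (i + + 1) + d (i - + 1)           ≡⟨ ℤP.+-comm (d (i + + 1)) _ ⟩
    d (i - + 1) + d (i + + 1)           ∎
  strict′ : ∀ i → d (+ i - + 1) + d (+ i + + 1) ≡ d (+ suc (suc i) - + 1) + d (+ suc (suc i) + + 1)
                → d (+ i - + 1) + d (+ i + + 1) ≡ + 0
  strict′ i eq with +-tight (below i) (above i) eq
  ... | lower-eq , upper-eq = begin
    d (+ i - + 1) + d (+ i + + 1)   ≡⟨ cong₂ _+_ lower-eq (up i) ⟩
    d (+ suc i) + d (+ suc i)       ≡⟨ cong₂ _+_ vanishes vanishes ⟩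
    + 0                             ∎
    where
    vanishes : d (+ suc i) ≡ + 0
    vanishes = strict t (suc i) (trans (sym (up i)) (trans upper-eq (up (suc (suc i)))))

𝒯²⇒InT2 : ∀ {d} → 𝒯² d → InT2 d
𝒯²⇒InT2 {d} t = nonneg t , symmetric t , λ r ℓ _ → decreasing r ℓ , strictly-decreasing r ℓ
  where
  r+[1+ℓ]*2≡2+r+ℓ*2 : ∀ r ℓ → r ℕ.+ suc ℓ ℕ.* 2 ≡ suc (suc (r ℕ.+ ℓ ℕ.* 2))
  r+[1+ℓ]*2≡2+r+ℓ*2 r ℓ = trans (ℕP.+-suc r _) (cong suc (ℕP.+-suc r _))
  decreasing : ∀ r ℓ → d (+ (r ℕ.+ suc ℓ ℕ.* 2)) ≤ d (+ (r ℕ.+ ℓ ℕ.* 2))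
  decreasing r ℓ rewrite r+[1+ℓ]*2≡2+r+ℓ*2 r ℓ = antitone t _
  strictly-decreasing : ∀ r ℓ → + 0 < d (+ (r ℕ.+ ℓ ℕ.* 2))
                        → d (+ (r ℕ.+ suc ℓ ℕ.* 2)) < d (+ (r ℕ.+ ℓ ℕ.* 2))
  strictly-decreasing r ℓ pos rewrite r+[1+ℓ]*2≡2+r+ℓ*2 r ℓ =
    ℤP.≤∧≢⇒< (antitone t _) (λ eq → ℤP.<-irrefl (sym (strict t _ (sym eq))) pos)

𝒯²zq : Series → Set
𝒯²zq D = ∀ n → 𝒯² (λ m → D m n)

𝒯²zq-cong : ∀ {D E} → D ≐ E → 𝒯²zq D → 𝒯²zq E
𝒯²zq-cong D≐E t n = 𝒯²-cong (λ m → D≐E m n) (t n)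

𝒯²zq-⊞ : ∀ {D E} → 𝒯²zq D → 𝒯²zq E → 𝒯²zq (D ⊞ E)
𝒯²zq-⊞ tD tE n = 𝒯²-+ (tD n) (tE n)

𝒯²zq-qShift : ∀ s {D} → 𝒯²zq D → 𝒯²zq (qShiftˢ s D)
𝒯²zq-qShift zero    t n       = t n
𝒯²zq-qShift (suc s) t zero    = 𝒯²-0
𝒯²zq-qShift (suc s) t (suc n) = 𝒯²zq-qShift s t n

𝒯²zq-z+z⁻¹ : ∀ {D} → 𝒯²zq D → 𝒯²zq (z+z⁻¹ D)
𝒯²zq-z+z⁻¹ t n = 𝒯²-z+z⁻¹ (t n)

𝒯²zq-one : 𝒯²zq ⟦ one ⟧
𝒯²zq-one zero    = 𝒯²-cong at-zero 𝒯²-δ₀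
  where
  at-zero : ∀ m → δ₀ m ≡ ⟦ one ⟧ m 0
  at-zero (+ zero)  = refl
  at-zero (+ suc _) = refl
  at-zero -[1+ _ ]  = refl
𝒯²zq-one (suc n) = 𝒯²-cong at-suc 𝒯²-0
  where
  at-suc : ∀ m → + 0 ≡ ⟦ one ⟧ m (suc n)
  at-suc (+ zero)  = refl
  at-suc (+ suc _) = refl
  at-suc -[1+ _ ]  = refl

𝒯²zq-binomialPair : ∀ s D → 𝒯²zq D → 𝒯²zq (binomial (- + 1) s · binomial (+ 1) s · D)
𝒯²zq-binomialPair s D t =
  𝒯²zq-cong (λ m n → sym (binomialPair-· s D m n))
    (𝒯²zq-⊞ (𝒯²zq-⊞ t (𝒯²zq-qShift s (𝒯²zq-z+z⁻¹ t))) (𝒯²zq-qShift s (𝒯²zq-qShift s t)))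

pochPair : ℕ → ℕ → Poly
pochPair s k = poch (mono (+ 1) s (- + 1)) k ⊗ poch (mono (- + 1) s (- + 1)) k

𝒯²zq-pochPair : ∀ s k → 𝒯²zq ⟦ pochPair s k ⟧
𝒯²zq-pochPair s zero    = 𝒯²zq-one
𝒯²zq-pochPair s (suc k) =
  𝒯²zq-cong (λ m n → sym (expand m n)) (𝒯²zq-binomialPair t ⟦ A ⊗ B ⟧ (𝒯²zq-pochPair s k))
  where
  t : ℕ
  t = k ℕ.+ s
  A B : Poly
  A = poch (mono (+ 1) s (- + 1)) k
  B = poch (mono (- + 1) s (- + 1)) k
  -- This left-hand side is pochPair s (suc k) by definition, as - (- + 1) reduces to + 1.
  expand : ⟦ (A ⊗ binomial (+ 1) t) ⊗ (B ⊗ binomial (- + 1) t) ⟧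
           ≐ binomial (- + 1) t · binomial (+ 1) t · ⟦ A ⊗ B ⟧
  expand m n = trans (⟦⊗⟧-factorʳ (A ⊗ binomial (+ 1) t) B (binomial (- + 1) t) m n)
                     (·-cong (binomial (- + 1) t) (⟦⊗⟧-factorˡ A B (binomial (+ 1) t)) m n)

𝒯²zq-shiftq : ∀ j P → 𝒯²zq ⟦ P ⟧ → 𝒯²zq ⟦ shiftq j P ⟧
𝒯²zq-shiftq j P t = 𝒯²zq-cong (λ m n → sym (⟦shiftq⟧ j P m n)) (𝒯²zq-qShift j t)

𝒯²zq-sumTo : ∀ N f → (∀ k → 𝒯²zq ⟦ f k ⟧) → 𝒯²zq ⟦ sumTo N f ⟧
𝒯²zq-sumTo zero    f t = t 0
𝒯²zq-sumTo (suc N) f t =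
  𝒯²zq-cong (λ m n → sym (⟦⟧-++ (sumTo N f) (f (suc N)) m n)) (𝒯²zq-⊞ (𝒯²zq-sumTo N f t) (t (suc N)))

theorem4p3 : InT2zq V × InT2zq X
theorem4p3 = (λ n → 𝒯²⇒InT2 (𝒯²zq-sumTo n (V-summand n) (𝒯²zq-V-summand n) n)) ,
             (λ n → 𝒯²⇒InT2 (𝒯²zq-sumTo n X-summand 𝒯²zq-X-summand n))
  where
  V-summand : ℕ → ℕ → Poly
  V-summand n k = shiftq k (pochPair (suc k) (suc n))
  𝒯²zq-V-summand : ∀ n k → 𝒯²zq ⟦ V-summand n k ⟧
  𝒯²zq-V-summand n k = 𝒯²zq-shiftq k (pochPair (suc k) (suc n)) (𝒯²zq-pochPair (suc k) (suc n))
  X-summand : ℕ → Poly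
  X-summand k = shiftq (suc k) (pochPair 1 k)
  𝒯²zq-X-summand : ∀ k → 𝒯²zq ⟦ X-summand k ⟧
  𝒯²zq-X-summand k = 𝒯²zq-shiftq (suc k) (pochPair 1 k) (𝒯²zq-pochPair 1 k)
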